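{- Let $n$ be a positive integer such that $3\| n$ and $p\| n$ for some odd prime $p$ with $p\equiv 2\pmod 3$. Then $n$ is neither near superperfect nor deficient superperfect.
   Context: $\sigma(m)$ denotes the sum of the positive divisors of $m$. For a prime $q$ and integer $a\ge1$, $q^a\| n$ means $q^a\mid n$ and $q^{a+1}\nmid n$. A positive integer $n$ is near superperfect if $2n+d=\sigma(\sigma(n))$ for some positive divisor $d$ of $n$, and deficient superperfect if $2n-d=\sigma(\sigma(n))$ for some positive divisor $d$ of $n$. -}

module Defs where

open import Data.Nat using (ℕ; suc; _+_; _*_; _^_; _≤_; _%_)
open import Data.Nat.Divisibility using (_∣_; _∣?_)
open import Data.Nat.ListAction using (sum)
open import Data.List using (List; map; filter; upTo)
open import Data.Product using (_×_; ∃-syntax)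
open import Relation.Nullary using (¬_)
open import Relation.Binary.PropositionalEquality using (_≡_)

divisors : ℕ → List ℕ
divisors m = filter (_∣? m) (map suc (upTo m))

σ : ℕ → ℕ
σ m = sum (divisors m)

ExactlyDivides : ℕ → ℕ → ℕ → Set
ExactlyDivides q a n = (q ^ a ∣ n) × ¬ (q ^ suc a ∣ n)

NearSuperperfect : ℕ → Set
NearSuperperfect n = ∃[ d ] (1 ≤ d × d ∣ n × 2 * n + d ≡ σ (σ n))

-- deficient superperfect: 2n - d = σ(σ(n)) for some positive divisor d of n
-- (stated as σ(σ(n)) + d = 2n to avoid truncated subtraction on ℕ)
DeficientSuperperfect : ℕ → Set
DeficientSuperperfect n = ∃[ d ] (1 ≤ d × d ∣ n × σ (σ n) + d ≡ 2 * n)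

{-# OPTIONS --safe #-}
module Submission where

-- Write n = 3pm with 3 ∤ pm and p ∤ m. Since σ(qM) = (1 + q)σ(M) for a prime q ∤ M,
-- σ(n) = 4(1 + p)σ(m), and p ≡ 2 (mod 3) makes this 12K with K = (p + 1)σ(m)/3.
-- As K, 2K, 3K, 4K, 6K and 12K all divide 12K, σ(σ(n)) ≥ 28K ≥ 28(p + 1)m/3 > 9pm = 3n,
-- whereas a near or deficient superperfect n has σ(σ(n)) ≤ 2n + n.

open import Defs
open import Algebra.Properties.CommutativeSemigroup using (interchange)
open import Data.List using ([]; _∷_; [_]; _++_; map; filter; upTo)
open import Data.List.Properties using (upTo-∷ʳ; map-++)
open import Data.List.Relation.Unary.All using (All; []; _∷_)
open import Data.List.Relation.Unary.Linked using (Linked; []; [-]; _∷_)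
open import Data.Nat
open import Data.Nat.Coprimality using (Coprime; coprime-divisor)
open import Data.Nat.Divisibility
open import Data.Nat.DivMod using (m≡m%n+[m/n]*n)
open import Data.Nat.ListAction using (sum)
open import Data.Nat.ListAction.Properties using (sum-++)
open import Data.Nat.Primality
  using (Prime; prime?; prime⇒irreducible; prime⇒nonZero; ¬prime[1]; euclidsLemma)
open import Data.Nat.Properties
open import Data.Nat.Tactic.RingSolver using (solve-∀)
open import Data.Product using (_×_; _,_; ∃-syntax)
open import Data.Sum using (inj₁; inj₂)
open import Function using (_∘′_)
open import Relation.Nullary using (¬_; yes; no; contradiction)
open import Relation.Nullary.Decidable using (True; toWitness)
open import Relation.Binary.PropositionalEquality
  using (_≡_; _≢_; refl; sym; trans; cong; cong₂; subst; module ≡-Reasoning)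

sumTo : (ℕ → ℕ) → ℕ → ℕ
sumTo f zero    = 0
sumTo f (suc k) = sumTo f k + f (suc k)

sumTo-cong : ∀ {f g} k → (∀ i → f i ≡ g i) → sumTo f k ≡ sumTo g k
sumTo-cong zero    f≗g = refl
sumTo-cong (suc k) f≗g = cong₂ _+_ (sumTo-cong k f≗g) (f≗g (suc k))

sumTo-+ : ∀ f g k → sumTo (λ i → f i + g i) k ≡ sumTo f k + sumTo g k
sumTo-+ f g zero    = refl
sumTo-+ f g (suc k) = begin
  sumTo (λ i → f i + g i) k + (f (suc k) + g (suc k))
    ≡⟨ cong (_+ (f (suc k) + g (suc k))) (sumTo-+ f g k) ⟩
  (sumTo f k + sumTo g k) + (f (suc k) + g (suc k))
    ≡⟨ interchange +-commutativeSemigroup (sumTo f k) (sumTo g k) (f (suc k)) (g (suc k)) ⟩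
  (sumTo f k + f (suc k)) + (sumTo g k + g (suc k)) ∎
  where open ≡-Reasoning

sumTo-*ˡ : ∀ c f k → sumTo (λ i → c * f i) k ≡ c * sumTo f k
sumTo-*ˡ c f zero    = sym (*-zeroʳ c)
sumTo-*ˡ c f (suc k) = trans (cong (_+ c * f (suc k)) (sumTo-*ˡ c f k))
                             (sym (*-distribˡ-+ c (sumTo f k) (f (suc k))))

sumTo-mono : ∀ f {a b} → a ≤ b → sumTo f a ≤ sumTo f b
sumTo-mono f = go ∘′ ≤⇒≤′
  where
  go : ∀ {a b} → a ≤′ b → sumTo f a ≤ sumTo f b
  go ≤′-refl       = ≤-refl
  go (≤′-step a≤b) = ≤-trans (go a≤b) (m≤m+n _ _)

sumTo-vanishing : ∀ f {M N} → (∀ i → M < i → i ≤ N → f i ≡ 0) → M ≤ N → sumTo f N ≡ sumTo f M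
sumTo-vanishing f vanish = go vanish ∘′ ≤⇒≤′
  where
  go : ∀ {M N} → (∀ i → M < i → i ≤ N → f i ≡ 0) → M ≤′ N → sumTo f N ≡ sumTo f M
  go vanish ≤′-refl                 = refl
  go {M} {suc N} vanish (≤′-step M≤N) = begin
    sumTo f N + f (suc N)  ≡⟨ cong₂ _+_ (go (λ i M<i i≤N → vanish i M<i (m≤n⇒m≤1+n i≤N)) M≤N)
                                        (vanish (suc N) (s≤s (≤′⇒≤ M≤N)) ≤-refl) ⟩
    sumTo f M + 0          ≡⟨ +-identityʳ _ ⟩
    sumTo f M              ∎
    where open ≡-Reasoning

sumTo-split : ∀ f a b → sumTo f (a + b) ≡ sumTo f a + sumTo (λ r → f (a + r)) b
sumTo-split f a zero    = trans (cong (sumTo f) (+-identityʳ a)) (sym (+-identityʳ _))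
sumTo-split f a (suc b) = begin
  sumTo f (a + suc b)
    ≡⟨ cong (sumTo f) (+-suc a b) ⟩
  sumTo f (a + b) + f (suc (a + b))
    ≡⟨ cong₂ _+_ (sumTo-split f a b) (cong f (sym (+-suc a b))) ⟩
  sumTo f a + sumTo (λ r → f (a + r)) b + f (a + suc b)
    ≡⟨ +-assoc (sumTo f a) _ _ ⟩
  sumTo f a + sumTo (λ r → f (a + r)) (suc b) ∎
  where open ≡-Reasoning

onMultiplesOf : ℕ → (ℕ → ℕ) → ℕ → ℕ
onMultiplesOf q f i with q ∣? i
... | yes _ = f i
... | no  _ = 0

onMultiplesOf-∣ : ∀ {q f i} → q ∣ i → onMultiplesOf q f i ≡ f i
onMultiplesOf-∣ {q} {f} {i} q∣i with q ∣? i
... | yes _   = refl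
... | no  q∤i = contradiction q∣i q∤i

onMultiplesOf-∤ : ∀ {q f i} → ¬ q ∣ i → onMultiplesOf q f i ≡ 0
onMultiplesOf-∤ {q} {f} {i} q∤i with q ∣? i
... | yes q∣i = contradiction q∣i q∤i
... | no  _   = refl

sumTo-onMultiplesOf : ∀ q .{{_ : NonZero q}} f N →
                      sumTo (onMultiplesOf q f) (q * N) ≡ sumTo (λ j → f (q * j)) N
sumTo-onMultiplesOf q f zero    = cong (sumTo (onMultiplesOf q f)) (*-zeroʳ q)
sumTo-onMultiplesOf q@(suc q′) f (suc N) = begin
  sumTo g (q * suc N)
    ≡⟨ cong (sumTo g) (trans (*-suc q N) (+-comm q (q * N))) ⟩
  sumTo g (q * N + q)
    ≡⟨ sumTo-split g (q * N) q ⟩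
  sumTo g (q * N) + (sumTo block q′ + g (q * N + q))
    ≡⟨ cong₂ (λ x y → sumTo g (q * N) + (x + y)) inner last ⟩
  sumTo g (q * N) + (0 + f (q * suc N))
    ≡⟨ cong (_+ f (q * suc N)) (sumTo-onMultiplesOf q f N) ⟩
  sumTo (λ j → f (q * j)) N + f (q * suc N) ∎
  where
  open ≡-Reasoning
  g : ℕ → ℕ
  g = onMultiplesOf q f
  block : ℕ → ℕ
  block r = g (q * N + r)
  inner : sumTo block q′ ≡ 0
  inner = sumTo-vanishing block (λ r 0<r r≤q′ → onMultiplesOf-∤ (q∤ r 0<r r≤q′)) z≤n
    where
    q∤ : ∀ r → 0 < r → r ≤ q′ → ¬ q ∣ q * N + r
    q∤ r 0<r r≤q′ q∣ = <⇒≱ (s≤s r≤q′) (∣⇒≤ {{>-nonZero 0<r}} (∣m+n∣m⇒∣n q∣ (m∣m*n N)))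
  last : g (q * N + q) ≡ f (q * suc N)
  last = trans (cong g (trans (+-comm (q * N) q) (sym (*-suc q N))))
               (onMultiplesOf-∣ {q} {f} (m∣m*n (suc N)))

divisorTerm : ℕ → ℕ → ℕ
divisorTerm N i with i ∣? N
... | yes _ = i
... | no  _ = 0

divisorTerm-∣ : ∀ {N i} → i ∣ N → divisorTerm N i ≡ i
divisorTerm-∣ {N} {i} i∣N with i ∣? N
... | yes _   = refl
... | no  i∤N = contradiction i∣N i∤N

divisorTerm-∤ : ∀ {N i} → ¬ i ∣ N → divisorTerm N i ≡ 0
divisorTerm-∤ {N} {i} i∤N with i ∣? N
... | yes i∣N = contradiction i∣N i∤N
... | no  _   = refl

sum-filter-∣ : ∀ N xs → sum (filter (_∣? N) xs) ≡ sum (map (divisorTerm N) xs)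
sum-filter-∣ N []       = refl
sum-filter-∣ N (x ∷ xs) with x ∣? N
... | yes _ = cong (x +_) (sum-filter-∣ N xs)
... | no  _ = sum-filter-∣ N xs

sum-map-upTo : ∀ f k → sum (map f (map suc (upTo k))) ≡ sumTo f k
sum-map-upTo f zero    = refl
sum-map-upTo f (suc k) = begin
  sum (map f (map suc (upTo (suc k))))
    ≡⟨ cong (λ l → sum (map f (map suc l))) (sym (upTo-∷ʳ k)) ⟩
  sum (map f (map suc (upTo k ++ [ k ])))
    ≡⟨ cong (λ l → sum (map f l)) (map-++ suc (upTo k) [ k ]) ⟩
  sum (map f (map suc (upTo k) ++ [ suc k ]))
    ≡⟨ cong sum (map-++ f (map suc (upTo k)) [ suc k ]) ⟩
  sum (map f (map suc (upTo k)) ++ [ f (suc k) ])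
    ≡⟨ sum-++ (map f (map suc (upTo k))) [ f (suc k) ] ⟩
  sum (map f (map suc (upTo k))) + (f (suc k) + 0)
    ≡⟨ cong₂ _+_ (sum-map-upTo f k) (+-identityʳ _) ⟩
  sumTo f k + f (suc k) ∎
  where open ≡-Reasoning

σ≡sumTo-divisorTerm : ∀ N → σ N ≡ sumTo (divisorTerm N) N
σ≡sumTo-divisorTerm N = trans (sum-filter-∣ N (map suc (upTo N))) (sum-map-upTo (divisorTerm N) N)

sumTo-divisorTerm-step : ∀ {N a b} → a < b → b ∣ N →
                         b + sumTo (divisorTerm N) a ≤ sumTo (divisorTerm N) b
sumTo-divisorTerm-step {N} {a} {suc b} (s≤s a≤b) b∣N = begin
  suc b + sumTo (divisorTerm N) a  ≤⟨ +-monoʳ-≤ (suc b) (sumTo-mono (divisorTerm N) a≤b) ⟩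
  suc b + sumTo (divisorTerm N) b  ≡⟨ +-comm (suc b) _ ⟩
  sumTo (divisorTerm N) b + suc b  ≡⟨ cong (sumTo (divisorTerm N) b +_) (divisorTerm-∣ b∣N) ⟨
  sumTo (divisorTerm N) (suc b)    ∎
  where open ≤-Reasoning

divisor-positive : ∀ {N d} .{{_ : NonZero N}} → d ∣ N → 0 < d
divisor-positive {N} {zero} 0∣N = contradiction (0∣⇒≡0 0∣N) (≢-nonZero⁻¹ N)
divisor-positive {N} {suc d} _  = z<s

sum-decreasingDivisors≤σ : ∀ {N ds} .{{_ : NonZero N}} →
                           Linked _>_ ds → All (_∣ N) ds → sum ds ≤ σ N
sum-decreasingDivisors≤σ []                                   []                  = z≤n
sum-decreasingDivisors≤σ {N} {d ∷ ds} decreasing divisors@(d∣N ∷ _) = begin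
  sum (d ∷ ds)                  ≤⟨ bounded decreasing divisors ⟩
  sumTo (divisorTerm N) d       ≤⟨ sumTo-mono (divisorTerm N) (∣⇒≤ d∣N) ⟩
  sumTo (divisorTerm N) N       ≡⟨ sym (σ≡sumTo-divisorTerm N) ⟩
  σ N                           ∎
  where
  open ≤-Reasoning
  bounded : ∀ {d ds} → Linked _>_ (d ∷ ds) → All (_∣ N) (d ∷ ds) →
            sum (d ∷ ds) ≤ sumTo (divisorTerm N) d
  bounded     [-]        (d∣N ∷ [])     = sumTo-divisorTerm-step (divisor-positive d∣N) d∣N
  bounded {d} (e<d ∷ es) (d∣N ∷ e∣N∷es) =
    ≤-trans (+-monoʳ-≤ d (bounded es e∣N∷es)) (sumTo-divisorTerm-step e<d d∣N)

n≤σ[n] : ∀ n .{{_ : NonZero n}} → n ≤ σ n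
n≤σ[n] n = ≤-trans (≤-reflexive (sym (+-identityʳ n))) (sum-decreasingDivisors≤σ [-] (∣-refl ∷ []))

28*K≤σ[12*K] : ∀ K → 28 * K ≤ σ (12 * K)
28*K≤σ[12*K] zero      = z≤n
28*K≤σ[12*K] K@(suc _) =
  subst (_≤ σ (12 * K)) (sum≡28K K) (sum-decreasingDivisors≤σ decreasing dividing)
  where
  decreasing : Linked _>_ (12 * K ∷ 6 * K ∷ 4 * K ∷ 3 * K ∷ 2 * K ∷ 1 * K ∷ [])
  decreasing = scaled 6 12 ∷ scaled 4 6 ∷ scaled 3 4 ∷ scaled 2 3 ∷ scaled 1 2 ∷ [-]
    where
    scaled : ∀ a b → {a<b : True (a <? b)} → b * K > a * K
    scaled a b {a<b} = *-monoˡ-< K (toWitness a<b)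
  dividing : All (_∣ 12 * K) (12 * K ∷ 6 * K ∷ 4 * K ∷ 3 * K ∷ 2 * K ∷ 1 * K ∷ [])
  dividing = scaled 12 (divides 1 refl) ∷ scaled 6 (divides 2 refl) ∷ scaled 4 (divides 3 refl)
           ∷ scaled 3 (divides 4 refl) ∷ scaled 2 (divides 6 refl) ∷ scaled 1 (divides 12 refl) ∷ []
    where
    scaled : ∀ a → a ∣ 12 → a * K ∣ 12 * K
    scaled a = *-monoˡ-∣ K
  sum≡28K : ∀ K → 12 * K + (6 * K + (4 * K + (3 * K + (2 * K + (1 * K + 0))))) ≡ 28 * K
  sum≡28K = solve-∀

prime∤⇒coprime : ∀ {q i} → Prime q → ¬ q ∣ i → Coprime i q
prime∤⇒coprime pq q∤i (d∣i , d∣q) with prime⇒irreducible pq d∣q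
... | inj₁ d≡1 = d≡1
... | inj₂ refl = contradiction d∣i q∤i

divisorTerm-*ˡ : ∀ q .{{_ : NonZero q}} M j → divisorTerm (q * M) (q * j) ≡ q * divisorTerm M j
divisorTerm-*ˡ q M j with j ∣? M
... | yes j∣M = divisorTerm-∣ (*-monoʳ-∣ q j∣M)
... | no  j∤M = trans (divisorTerm-∤ (j∤M ∘′ *-cancelˡ-∣ q)) (sym (*-zeroʳ q))

divisorTerm-*-prime∤ : ∀ {q M i} → Prime q → ¬ q ∣ i → divisorTerm (q * M) i ≡ divisorTerm M i
divisorTerm-*-prime∤ {q} {M} {i} pq q∤i with i ∣? M
... | yes i∣M = divisorTerm-∣ (∣-trans i∣M (n∣m*n q))
... | no  i∤M = divisorTerm-∤ (i∤M ∘′ coprime-divisor (prime∤⇒coprime pq q∤i))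

divisorTerm-*-prime : ∀ {q M} → Prime q → ¬ q ∣ M → ∀ i →
                      divisorTerm (q * M) i ≡ divisorTerm M i + onMultiplesOf q (divisorTerm (q * M)) i
divisorTerm-*-prime {q} {M} pq q∤M i with q ∣? i
... | yes q∣i = sym (cong (_+ divisorTerm (q * M) i) (divisorTerm-∤ (q∤M ∘′ ∣-trans q∣i)))
... | no  q∤i = trans (divisorTerm-*-prime∤ pq q∤i) (sym (+-identityʳ _))

σ-*-prime : ∀ {q M} → Prime q → ¬ q ∣ M → σ (q * M) ≡ (1 + q) * σ M
σ-*-prime {q} {zero}      pq q∤M = contradiction (q ∣0) q∤M
σ-*-prime {q} {M@(suc _)} pq q∤M = begin
  σ (q * M)
    ≡⟨ σ≡sumTo-divisorTerm (q * M) ⟩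
  sumTo (divisorTerm (q * M)) (q * M)
    ≡⟨ sumTo-cong (q * M) (divisorTerm-*-prime pq q∤M) ⟩
  sumTo (λ i → divisorTerm M i + multiples i) (q * M)
    ≡⟨ sumTo-+ (divisorTerm M) multiples (q * M) ⟩
  sumTo (divisorTerm M) (q * M) + sumTo multiples (q * M)
    ≡⟨ cong₂ _+_ (sumTo-vanishing (divisorTerm M) beyondM (m≤n*m M q))
                 (sumTo-onMultiplesOf q (divisorTerm (q * M)) M) ⟩
  sumTo (divisorTerm M) M + sumTo (λ j → divisorTerm (q * M) (q * j)) M
    ≡⟨ cong (sumTo (divisorTerm M) M +_) (sumTo-cong M (divisorTerm-*ˡ q M)) ⟩
  sumTo (divisorTerm M) M + sumTo (λ j → q * divisorTerm M j) M
    ≡⟨ cong (sumTo (divisorTerm M) M +_) (sumTo-*ˡ q (divisorTerm M) M) ⟩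
  sumTo (divisorTerm M) M + q * sumTo (divisorTerm M) M
    ≡⟨ cong (λ s → s + q * s) (σ≡sumTo-divisorTerm M) ⟨
  (1 + q) * σ M ∎
  where
  open ≡-Reasoning
  instance _ = prime⇒nonZero pq
  multiples : ℕ → ℕ
  multiples = onMultiplesOf q (divisorTerm (q * M))
  beyondM : ∀ i → M < i → i ≤ q * M → divisorTerm M i ≡ 0
  beyondM i M<i _ = divisorTerm-∤ (λ i∣M → <⇒≱ M<i (∣⇒≤ i∣M))

distinctPrimes⇒∤ : ∀ {p q} → Prime p → Prime q → p ≢ q → ¬ p ∣ q
distinctPrimes⇒∤ pp pq p≢q p∣q with prime⇒irreducible pq p∣q
... | inj₁ refl = ¬prime[1] pp
... | inj₂ p≡q  = p≢q p≡q

exactlyDivides¹ : ∀ {q n} → ExactlyDivides q 1 n → q ∣ n × ¬ q * q ∣ n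
exactlyDivides¹ {q} {n} (q∣n , q²∤n) =
  subst (_∣ n) (*-identityʳ q) q∣n , q²∤n ∘′ subst (_∣ n) (cong (q *_) (sym (*-identityʳ q)))

exactlyDividesDistinctPrimes : ∀ {q p n} → Prime q → Prime p → p ≢ q →
                               ExactlyDivides q 1 n → ExactlyDivides p 1 n →
                               ∃[ m ] (n ≡ q * (p * m) × ¬ q ∣ p * m × ¬ p ∣ m)
exactlyDividesDistinctPrimes {q} {p} pq pp p≢q q∥n p∥n
  with exactlyDivides¹ {q} q∥n | exactlyDivides¹ {p} p∥n
... | divides-refl a , q²∤n | p∣n , p²∤n with euclidsLemma a q pp p∣n
...   | inj₂ p∣q              = contradiction p∣q (distinctPrimes⇒∤ pp pq p≢q)
...   | inj₁ (divides-refl m) = m , reorder m p q , q∤pm , p∤m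
  where
  reorder : ∀ m p q → m * p * q ≡ q * (p * m)
  reorder = solve-∀
  q∤pm : ¬ q ∣ p * m
  q∤pm q∣pm = q²∤n (subst (q * q ∣_) (trans (*-comm q (p * m)) (cong (_* q) (*-comm p m)))
                          (*-monoʳ-∣ q q∣pm))
  p∤m : ¬ p ∣ m
  p∤m p∣m = p²∤n (∣-trans (*-monoˡ-∣ p p∣m) (m∣m*n q))

9*[3u+2]*m<28*[u+1]*m : ∀ u m .{{_ : NonZero m}} → 3 * (3 * ((2 + u * 3) * m)) < 28 * (suc u * m)
9*[3u+2]*m<28*[u+1]*m u (suc m) = begin-strict
  3 * (3 * ((2 + u * 3) * suc m))                                 <⟨ m<m+n _ z<s ⟩
  3 * (3 * ((2 + u * 3) * suc m)) + suc (9 + u + (10 + u) * m)    ≡⟨ difference u m ⟨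
  28 * (suc u * suc m)                                            ∎
  where
  open ≤-Reasoning
  difference : ∀ u m → 28 * (suc u * suc m) ≡
                       3 * (3 * ((2 + u * 3) * suc m)) + suc (9 + u + (10 + u) * m)
  difference = solve-∀

prime3 : Prime 3
prime3 = toWitness {a? = prime? 3} _

σ[σ[3pm]]>9pm : ∀ {p m} → Prime p → p % 3 ≡ 2 → ¬ 3 ∣ p * m → ¬ p ∣ m →
                3 * (3 * (p * m)) < σ (σ (3 * (p * m)))
σ[σ[3pm]]>9pm {p} {zero}      pp p%3≡2 3∤pm p∤0 = contradiction (p ∣0) p∤0
σ[σ[3pm]]>9pm {p} {m@(suc _)} pp p%3≡2 3∤pm p∤m = begin-strict
  3 * (3 * (p * m))                      ≡⟨ cong (λ p → 3 * (3 * (p * m))) p≡2+3u ⟩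
  3 * (3 * ((2 + u * 3) * m))            <⟨ 9*[3u+2]*m<28*[u+1]*m u m ⟩
  28 * (suc u * m)                       ≤⟨ *-monoʳ-≤ 28 (*-monoʳ-≤ (suc u) (n≤σ[n] m)) ⟩
  28 * (suc u * σ m)                     ≤⟨ 28*K≤σ[12*K] (suc u * σ m) ⟩
  σ (12 * (suc u * σ m))                 ≡⟨ cong σ σ[3pm] ⟨
  σ (σ (3 * (p * m)))                    ∎
  where
  open ≤-Reasoning
  u : ℕ
  u = p / 3
  p≡2+3u : p ≡ 2 + u * 3
  p≡2+3u = trans (m≡m%n+[m/n]*n p 3) (cong (_+ u * 3) p%3≡2)
  σ[3pm] : σ (3 * (p * m)) ≡ 12 * (suc u * σ m)
  σ[3pm] = begin-equality
    σ (3 * (p * m))                ≡⟨ σ-*-prime prime3 3∤pm ⟩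
    4 * σ (p * m)                  ≡⟨ cong (4 *_) (σ-*-prime pp p∤m) ⟩
    4 * ((1 + p) * σ m)            ≡⟨ cong (λ p → 4 * ((1 + p) * σ m)) p≡2+3u ⟩
    4 * ((3 + u * 3) * σ m)        ≡⟨ regroup u (σ m) ⟩
    12 * (suc u * σ m)             ∎
    where
    regroup : ∀ u s → 4 * ((3 + u * 3) * s) ≡ 12 * (suc u * s)
    regroup = solve-∀

σ[σ[n]]>3n⇒¬NearSuperperfect : ∀ {n} .{{_ : NonZero n}} → 3 * n < σ (σ n) → ¬ NearSuperperfect n
σ[σ[n]]>3n⇒¬NearSuperperfect {n} 3n<σσn (d , _ , d∣n , 2n+d≡σσn) = <⇒≱ 3n<σσn (begin
  σ (σ n)     ≡⟨ 2n+d≡σσn ⟨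
  2 * n + d   ≤⟨ +-monoʳ-≤ (2 * n) (∣⇒≤ d∣n) ⟩
  2 * n + n   ≡⟨ +-comm (2 * n) n ⟩
  3 * n       ∎)
  where open ≤-Reasoning

σ[σ[n]]>2n⇒¬DeficientSuperperfect : ∀ {n} → 2 * n < σ (σ n) → ¬ DeficientSuperperfect n
σ[σ[n]]>2n⇒¬DeficientSuperperfect {n} 2n<σσn (d , _ , _ , σσn+d≡2n) =
  <⇒≱ 2n<σσn (≤-trans (m≤m+n (σ (σ n)) d) (≤-reflexive σσn+d≡2n))

mainTheorem15 : (n : ℕ) → 1 ≤ n → ExactlyDivides 3 1 n →
    (∃[ p ] (Prime p × p ≢ 2 × p % 3 ≡ 2 × ExactlyDivides p 1 n)) →
    ¬ NearSuperperfect n × ¬ DeficientSuperperfect n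
mainTheorem15 n 1≤n 3∥n (p , pp , _ , p%3≡2 , p∥n)
  with exactlyDividesDistinctPrimes prime3 pp (λ { refl → contradiction p%3≡2 λ () }) 3∥n p∥n
... | m , refl , 3∤pm , p∤m =
  σ[σ[n]]>3n⇒¬NearSuperperfect 3n<σσn ,
  σ[σ[n]]>2n⇒¬DeficientSuperperfect (≤-<-trans (m≤n+m (2 * n) n) 3n<σσn)
  where
  instance _ = >-nonZero 1≤n
  3n<σσn : 3 * n < σ (σ n)
  3n<σσn = σ[σ[3pm]]>9pm pp p%3≡2 3∤pm p∤m
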